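{- Let $G$ be a finite simple graph and $a$ a vertex of $G$. Then, whenever $x\neq 1-y$, \[ J(G\mid N_G[a]\cap W=\emptyset)=\frac{J(G)-x\,y^{|N_G(a)|}J(G-N_G[a])-x\,J(G\backslash a)-y\,J(G-a)}{1-x-y}. \]
   Context: For a finite simple graph $G$ and $W\subseteq V(G)$, $N_G[W]$ is the set of vertices that are in $W$ or adjacent to a vertex of $W$, and $N_G(W):=N_G[W]\setminus W$; for a vertex $a$, $N_G(a)$ is the set of neighbours of $a$ and $N_G[a]=N_G(a)\cup\{a\}$. The bivariate domination polynomial is $J(G;x,y)=J(G):=\sum_{W\subseteq V(G)} x^{|W|}y^{|N_G(W)|}$ (the graph with no vertices has $J=1$). For a condition $c(W)$ on subsets $W\subseteq V(G)$, $J(G\mid c(W))$ is the same sum taken only over those $W$ satisfying $c(W)$. For $X\subseteq V(G)$, $G-X$ is obtained by deleting the vertices of $X$. The vertex contraction $G\backslash a$ is the graph obtained from $G$ by adding edges between all pairs of vertices of $N_G(a)$ and then deleting $a$. -}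

module Defs where

open import Level using (0ℓ)
open import Data.Nat as ℕ using (ℕ; zero; suc)
open import Data.Bool using (Bool; true; false; _∧_; _∨_; not; if_then_else_)
open import Data.Fin using (Fin)
import Data.Fin as Fin
open import Data.Fin.Subset using (Subset; ⊤; _─_; ⁅_⁆)
open import Data.Vec using (Vec; []; _∷_; lookup; tabulate)
open import Data.List using (List; []; _∷_; map; _++_; allFin; foldr)
open import Data.Bool.ListAction using (any; all)
open import Data.Product using (_×_)
open import Data.Rational using (ℚ; 0ℚ; 1ℚ; _+_; _*_; _-_; -_; _÷_; ≢-nonZero)
import Data.Rational.Properties
import Relation.Binary.PropositionalEquality
open import Relation.Nullary.Decidable using (isYes)
open import Relation.Binary.PropositionalEquality using (_≡_; _≢_; refl; sym; trans; cong)

Adj : ℕ → Set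
Adj n = Fin n → Fin n → Bool

IsSimpleGraph : ∀ {n} → Adj n → Set
IsSimpleGraph {n} adj = (∀ (u v : Fin n) → adj u v ≡ adj v u) × (∀ (v : Fin n) → adj v v ≡ false)

subsets : ∀ n → List (Subset n)
subsets zero = [] ∷ []
subsets (suc n) = map (false ∷_) (subsets n) ++ map (true ∷_) (subsets n)

count : ∀ {n} → (Fin n → Bool) → ℕ
count {n} p = foldr (λ v k → if p v then suc k else k) 0 (allFin n)

anyV : ∀ {n} → (Fin n → Bool) → Bool
anyV {n} p = any p (allFin n)

allV : ∀ {n} → (Fin n → Bool) → Bool
allV {n} p = all p (allFin n)

_∈ᵇ_ : ∀ {n} → Fin n → Subset n → Bool
v ∈ᵇ W = lookup W v

_⊆ᵇ_ : ∀ {n} → Subset n → Subset n → Bool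
W ⊆ᵇ S = allV (λ v → not (v ∈ᵇ W) ∨ (v ∈ᵇ S))

size : ∀ {n} → Subset n → ℕ
size W = count (λ v → v ∈ᵇ W)

nbrSize : ∀ {n} → Adj n → Subset n → Subset n → ℕ
nbrSize adj S W =
  count (λ v → (v ∈ᵇ S) ∧ not (v ∈ᵇ W) ∧ anyV (λ w → (w ∈ᵇ W) ∧ adj w v))

closedNbhd : ∀ {n} → Adj n → Fin n → Subset n
closedNbhd adj a = tabulate (λ v → isYes (v Fin.≟ a) ∨ adj a v)

degree : ∀ {n} → Adj n → Fin n → ℕ
degree adj a = count (λ v → adj a v)

-- vertex contraction G \ a (as an adjacency on Fin n; the vertex a is then
-- removed by restricting to the vertex set ⊤ ─ ⁅ a ⁆)
contractAdj : ∀ {n} → Adj n → Fin n → Adj n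
contractAdj adj a u v = adj u v ∨ (adj a u ∧ adj a v ∧ not (isYes (u Fin.≟ v)))

_^_ : ℚ → ℕ → ℚ
p ^ zero = 1ℚ
p ^ suc k = p * (p ^ k)

-- J(G[S] | c(W)) for the induced subgraph of adj on S, evaluated at x,y ∈ ℚ:
-- sum over W ⊆ S with c W of x^|W| y^|N(W)|
Jc : ∀ {n} → Adj n → Subset n → (Subset n → Bool) → ℚ → ℚ → ℚ
Jc {n} adj S c x y =
  foldr (λ W acc → (if (W ⊆ᵇ S) ∧ c W then (x ^ size W) * (y ^ nbrSize adj S W) else 0ℚ) + acc)
        0ℚ (subsets n)

J : ∀ {n} → Adj n → Subset n → ℚ → ℚ → ℚ
J adj S x y = Jc adj S (λ _ → true) x y

disjointᵇ : ∀ {n} → Subset n → Subset n → Bool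
disjointᵇ W X = allV (λ v → not ((v ∈ᵇ W) ∧ (v ∈ᵇ X)))

private
  open Data.Rational.Properties using (+-assoc; +-comm; +-inverseʳ; +-identityˡ; +-identityʳ)
  open Relation.Binary.PropositionalEquality.≡-Reasoning
  lem : ∀ (x y : ℚ) → x + ((1ℚ - x) - y) ≡ 1ℚ - y
  lem x y = begin
    x + ((1ℚ + - x) + - y)   ≡⟨ sym (+-assoc x (1ℚ + - x) (- y)) ⟩
    (x + (1ℚ + - x)) + - y   ≡⟨ cong (λ t → (x + t) + - y) (+-comm 1ℚ (- x)) ⟩
    (x + (- x + 1ℚ)) + - y   ≡⟨ cong (_+ - y) (sym (+-assoc x (- x) 1ℚ)) ⟩
    ((x + - x) + 1ℚ) + - y   ≡⟨ cong (λ t → (t + 1ℚ) + - y) (+-inverseʳ x) ⟩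
    (0ℚ + 1ℚ) + - y          ≡⟨ cong (_+ - y) (+-identityˡ 1ℚ) ⟩
    1ℚ + - y ∎

nonzero-denom : ∀ (x y : ℚ) → x ≢ 1ℚ - y → (1ℚ - x) - y ≢ 0ℚ
nonzero-denom x y h e = h (trans (sym (trans (cong (x +_) e) (+-identityʳ x))) (lem x y))

divDenom : (p x y : ℚ) → x ≢ 1ℚ - y → ℚ
divDenom p x y h = _÷_ p ((1ℚ - x) - y) {{≢-nonZero (nonzero-denom x y h)}}

module Submission where

-- Each of the five polynomials is a sum over all W ⊆ V of a weight x^|W| y^|N(W)|
-- (zero for inadmissible W), so it suffices that the sum of the corresponding
-- alternating combination ω(W) of weights vanishes.  We pair every W ∌ a with
-- W ∪ {a} and show ω(W) + ω(W ∪ {a}) = 0: for W ∪ {a} only the J(G) weight survives,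
-- and for W we split on whether a has a neighbour in W, comparing |N(W)| and
-- |N(W ∪ {a})| in G with the neighbourhood sizes of W in G - a, G - N[a] and G \ a.

open import Defs
open import Algebra.Bundles using (CommutativeMonoid)
import Algebra.Properties.CommutativeSemigroup as CommSemigroupProps
open import Data.Nat using (ℕ; zero; suc) renaming (_+_ to _+ℕ_)
import Data.Nat.Properties as ℕP
open import Data.Bool using (Bool; true; false; _∧_; _∨_; not; if_then_else_)
open import Data.Bool.Properties
  using (∨-comm; ∧-comm; ∨-identityʳ; ∨-zeroʳ; ∧-identityʳ; ∧-zeroʳ; ∧-distribʳ-∨; ∨-commutativeMonoid)
open import Data.Bool.ListAction using (any; all)
open import Data.Fin using (Fin; zero; suc)
import Data.Fin as Fin
open import Data.Fin.Subset using (Subset; ⊤; _─_; ⁅_⁆)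
open import Data.Vec using (_∷_; _[_]≔_)
open import Data.Vec.Properties using (lookup-replicate; lookup∘tabulate; lookup∘update; lookup∘update′)
open import Data.List using (List; []; _∷_; map; _++_; foldr; allFin)
import Data.List as List
open import Data.List.Properties using (map-tabulate)
open import Data.List.Relation.Unary.Any using (here; there)
open import Data.List.Membership.Propositional using (_∈_)
open import Data.List.Membership.Propositional.Properties using (∈-allFin)
open import Data.Empty using (⊥-elim)
open import Data.Product using (_,_)
open import Data.Rational using (ℚ; 0ℚ; 1ℚ; _+_; _*_; _-_; _÷_; 1/_; NonZero; ≢-nonZero)
import Data.Rational.Properties as ℚP
open import Data.Rational.Solver using (module +-*-Solver)
open import Relation.Nullary using (yes; no)
open import Relation.Nullary.Decidable using (isYes)
open import Relation.Binary.PropositionalEquality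
  using (_≡_; _≢_; refl; sym; trans; cong; cong₂; module ≡-Reasoning)

open ≡-Reasoning
open +-*-Solver

open import Algebra.Properties.Group ℚP.+-0-group using (x∙y⁻¹≈ε⇒x≈y)
open CommSemigroupProps ℕP.+-commutativeSemigroup using () renaming (interchange to +-interchange)
open CommSemigroupProps (CommutativeMonoid.commutativeSemigroup ∨-commutativeMonoid)
  using () renaming (interchange to ∨-interchange)

bit : Bool → ℕ
bit true  = 1
bit false = 0

_==_ : ∀ {n} → Fin n → Fin n → Bool
u == v = isYes (u Fin.≟ v)

==-refl : ∀ {n} (a : Fin n) → (a == a) ≡ true
==-refl a with a Fin.≟ a
... | yes _   = refl
... | no a≢a = ⊥-elim (a≢a refl)

==-suc : ∀ {n} (u v : Fin n) → (suc u == suc v) ≡ (u == v)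
==-suc u v with u Fin.≟ v
... | yes _ = refl
... | no _  = refl

tally : ∀ {A : Set} → (A → Bool) → List A → ℕ
tally p = foldr (λ v k → if p v then suc k else k) 0

module _ {A : Set} where

  tally-∷ : ∀ (p : A → Bool) v xs → tally p (v ∷ xs) ≡ bit (p v) +ℕ tally p xs
  tally-∷ p v xs with p v
  ... | true  = refl
  ... | false = refl

  tally-cong : ∀ {p q : A → Bool} → (∀ v → p v ≡ q v) → ∀ xs → tally p xs ≡ tally q xs
  tally-cong e []       = refl
  tally-cong e (v ∷ xs) rewrite e v | tally-cong e xs = refl

  tally-none : ∀ {p : A → Bool} → (∀ v → p v ≡ false) → ∀ xs → tally p xs ≡ 0
  tally-none e []       = refl
  tally-none e (v ∷ xs) rewrite e v = tally-none e xs

  tally-+ : ∀ {p q r : A → Bool} → (∀ v → bit (p v) +ℕ bit (q v) ≡ bit (r v)) →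
            ∀ xs → tally p xs +ℕ tally q xs ≡ tally r xs
  tally-+ e [] = refl
  tally-+ {p} {q} {r} e (v ∷ xs) = begin
    tally p (v ∷ xs) +ℕ tally q (v ∷ xs)
      ≡⟨ cong₂ _+ℕ_ (tally-∷ p v xs) (tally-∷ q v xs) ⟩
    (bit (p v) +ℕ tally p xs) +ℕ (bit (q v) +ℕ tally q xs)
      ≡⟨ +-interchange (bit (p v)) (tally p xs) (bit (q v)) (tally q xs) ⟩
    (bit (p v) +ℕ bit (q v)) +ℕ (tally p xs +ℕ tally q xs)
      ≡⟨ cong₂ _+ℕ_ (e v) (tally-+ e xs) ⟩
    bit (r v) +ℕ tally r xs
      ≡⟨ sym (tally-∷ r v xs) ⟩
    tally r (v ∷ xs) ∎

  tally-map : ∀ {B : Set} (f : B → A) (p : A → Bool) xs → tally p (map f xs) ≡ tally (λ v → p (f v)) xs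
  tally-map f p []       = refl
  tally-map f p (v ∷ xs) rewrite tally-map f p xs = refl

  any-cong : ∀ {p q : A → Bool} → (∀ v → p v ≡ q v) → ∀ xs → any p xs ≡ any q xs
  any-cong e []       = refl
  any-cong e (v ∷ xs) = cong₂ _∨_ (e v) (any-cong e xs)

  any-∨ : ∀ (p q : A → Bool) xs → any (λ v → p v ∨ q v) xs ≡ any p xs ∨ any q xs
  any-∨ p q []       = refl
  any-∨ p q (v ∷ xs) =
    trans (cong ((p v ∨ q v) ∨_) (any-∨ p q xs)) (∨-interchange (p v) (q v) (any p xs) (any q xs))

  any-∧ʳ : ∀ (p : A → Bool) b xs → any (λ v → p v ∧ b) xs ≡ any p xs ∧ b
  any-∧ʳ p b []       = refl
  any-∧ʳ p b (v ∷ xs) = trans (cong ((p v ∧ b) ∨_) (any-∧ʳ p b xs)) (sym (∧-distribʳ-∨ b (p v) (any p xs)))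

  any-∈ : ∀ {p : A → Bool} {v xs} → v ∈ xs → p v ≡ true → any p xs ≡ true
  any-∈ (here refl) e rewrite e = refl
  any-∈ {p} (there {x = u} m) e = trans (cong (p u ∨_) (any-∈ m e)) (∨-zeroʳ (p u))

  any-none : ∀ {p : A → Bool} → (∀ v → p v ≡ false) → ∀ xs → any p xs ≡ false
  any-none e []       = refl
  any-none e (v ∷ xs) rewrite e v = any-none e xs

  all-every : ∀ {p : A → Bool} → (∀ v → p v ≡ true) → ∀ xs → all p xs ≡ true
  all-every e []       = refl
  all-every e (v ∷ xs) rewrite e v = all-every e xs

  all-cong : ∀ {p q : A → Bool} → (∀ v → p v ≡ q v) → ∀ xs → all p xs ≡ all q xs
  all-cong e []       = refl
  all-cong e (v ∷ xs) = cong₂ _∧_ (e v) (all-cong e xs)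

  all-not : ∀ (p : A → Bool) xs → all (λ v → not (p v)) xs ≡ not (any p xs)
  all-not p []       = refl
  all-not p (v ∷ xs) with p v
  ... | true  = refl
  ... | false = all-not p xs

count-suc : ∀ {n} (p : Fin (suc n) → Bool) → count p ≡ bit (p zero) +ℕ count (λ v → p (suc v))
count-suc {n} p = begin
  count p                                          ≡⟨ tally-∷ p zero (List.tabulate suc) ⟩
  bit (p zero) +ℕ tally p (List.tabulate suc)      ≡⟨ cong (λ vs → bit (p zero) +ℕ tally p vs) (sym (map-tabulate (λ v → v) suc)) ⟩
  bit (p zero) +ℕ tally p (map suc (allFin n))     ≡⟨ cong (bit (p zero) +ℕ_) (tally-map suc p (allFin n)) ⟩
  bit (p zero) +ℕ count (λ v → p (suc v))          ∎

count-single : ∀ {n} (a : Fin n) → count (λ v → v == a) ≡ 1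
count-single {suc n} zero = begin
  count {suc n} (λ v → v == zero)          ≡⟨ count-suc {n} (λ v → v == zero) ⟩
  suc (count {n} (λ v → suc v == zero))    ≡⟨ cong suc (tally-none (λ _ → refl) (allFin n)) ⟩
  1                                        ∎
count-single {suc n} (suc a) = begin
  count (λ v → v == suc a)                 ≡⟨ count-suc (λ v → v == suc a) ⟩
  count (λ v → suc v == suc a)             ≡⟨ tally-cong (λ v → ==-suc v a) (allFin n) ⟩
  count (λ v → v == a)                     ≡⟨ count-single a ⟩
  1                                        ∎

count-at : ∀ {n} (a : Fin n) (b : Bool) → count (λ v → (v == a) ∧ b) ≡ bit b
count-at {n} a true  = trans (tally-cong (λ v → ∧-identityʳ (v == a)) (allFin n)) (count-single a)
count-at {n} a false = tally-none (λ v → ∧-zeroʳ (v == a)) (allFin n)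

any-at : ∀ {n} (a : Fin n) (p : Fin n → Bool) → anyV (λ v → (v == a) ∧ p v) ≡ p a
any-at {n} a p with p a in pa
... | true  = any-∈ (∈-allFin a) (trans (cong (_∧ p a) (==-refl a)) pa)
... | false = any-none only-a (allFin n)
  where
    only-a : ∀ v → (v == a) ∧ p v ≡ false
    only-a v with v Fin.≟ a
    ... | yes refl = pa
    ... | no _     = refl

lookup-⊤ : ∀ {n} (v : Fin n) → v ∈ᵇ ⊤ ≡ true
lookup-⊤ v = lookup-replicate v true

lookup-⊤─ : ∀ {n} (X : Subset n) (v : Fin n) → v ∈ᵇ (⊤ ─ X) ≡ not (v ∈ᵇ X)
lookup-⊤─ (true  ∷ X) zero    = refl
lookup-⊤─ (false ∷ X) zero    = refl
lookup-⊤─ (_     ∷ X) (suc v) = lookup-⊤─ X v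

lookup-⁅⁆ : ∀ {n} (a v : Fin n) → v ∈ᵇ ⁅ a ⁆ ≡ (v == a)
lookup-⁅⁆ zero    zero    = refl
lookup-⁅⁆ zero    (suc v) = lookup-replicate v false
lookup-⁅⁆ (suc a) zero    = refl
lookup-⁅⁆ (suc a) (suc v) = trans (lookup-⁅⁆ a v) (sym (==-suc v a))

lookup-closedNbhd : ∀ {n} (adj : Adj n) (a v : Fin n) → v ∈ᵇ closedNbhd adj a ≡ (v == a) ∨ adj a v
lookup-closedNbhd adj a v = lookup∘tabulate (λ u → (u == a) ∨ adj a u) v

lookup-insert : ∀ {n} (W : Subset n) (a v : Fin n) → v ∈ᵇ (W [ a ]≔ true) ≡ (v == a) ∨ (v ∈ᵇ W)
lookup-insert W a v with v Fin.≟ a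
... | yes refl = lookup∘update v W true
... | no v≢a   = lookup∘update′ v≢a W true

disjoint-any : ∀ {n} (X W : Subset n) → disjointᵇ X W ≡ not (anyV (λ v → (v ∈ᵇ X) ∧ (v ∈ᵇ W)))
disjoint-any {n} X W = all-not (λ v → (v ∈ᵇ X) ∧ (v ∈ᵇ W)) (allFin n)

⊆-⊤ : ∀ {n} (W : Subset n) → W ⊆ᵇ ⊤ ≡ true
⊆-⊤ {n} W = all-every (λ v → trans (cong (not (v ∈ᵇ W) ∨_) (lookup-⊤ v)) (∨-zeroʳ _)) (allFin n)

⊆-complement : ∀ {n} (X W : Subset n) → W ⊆ᵇ (⊤ ─ X) ≡ disjointᵇ X W
⊆-complement {n} X W = all-cong pointwise (allFin n)
  where
    pointwise : ∀ v → not (v ∈ᵇ W) ∨ (v ∈ᵇ (⊤ ─ X)) ≡ not ((v ∈ᵇ X) ∧ (v ∈ᵇ W))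
    pointwise v rewrite lookup-⊤─ X v with v ∈ᵇ X | v ∈ᵇ W
    ... | true  | true  = refl
    ... | true  | false = refl
    ... | false | true  = refl
    ... | false | false = refl

disjoint-⁅⁆ : ∀ {n} (a : Fin n) (W : Subset n) → disjointᵇ ⁅ a ⁆ W ≡ not (a ∈ᵇ W)
disjoint-⁅⁆ {n} a W = begin
  disjointᵇ ⁅ a ⁆ W                               ≡⟨ disjoint-any ⁅ a ⁆ W ⟩
  not (anyV (λ v → (v ∈ᵇ ⁅ a ⁆) ∧ (v ∈ᵇ W)))      ≡⟨ cong not (any-cong (λ v → cong (_∧ (v ∈ᵇ W)) (lookup-⁅⁆ a v)) (allFin n)) ⟩
  not (anyV (λ v → (v == a) ∧ (v ∈ᵇ W)))          ≡⟨ cong not (any-at a (λ v → v ∈ᵇ W)) ⟩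
  not (a ∈ᵇ W)                                    ∎

hasNbr : ∀ {n} → Adj n → Subset n → Fin n → Bool
hasNbr ad W v = anyV (λ w → (w ∈ᵇ W) ∧ ad w v)

hasNbr-insert : ∀ {n} (ad : Adj n) (W : Subset n) (a v : Fin n) →
                hasNbr ad (W [ a ]≔ true) v ≡ ad a v ∨ hasNbr ad W v
hasNbr-insert {n} ad W a v = begin
  hasNbr ad (W [ a ]≔ true) v
    ≡⟨ any-cong split (allFin n) ⟩
  anyV (λ w → ((w == a) ∧ ad w v) ∨ ((w ∈ᵇ W) ∧ ad w v))
    ≡⟨ any-∨ (λ w → (w == a) ∧ ad w v) (λ w → (w ∈ᵇ W) ∧ ad w v) (allFin n) ⟩
  anyV (λ w → (w == a) ∧ ad w v) ∨ hasNbr ad W v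
    ≡⟨ cong (_∨ hasNbr ad W v) (any-at a (λ w → ad w v)) ⟩
  ad a v ∨ hasNbr ad W v ∎
  where
    split : ∀ w → (w ∈ᵇ (W [ a ]≔ true)) ∧ ad w v ≡ ((w == a) ∧ ad w v) ∨ ((w ∈ᵇ W) ∧ ad w v)
    split w = trans (cong (_∧ ad w v) (lookup-insert W a w)) (∧-distribʳ-∨ (ad w v) (w == a) (w ∈ᵇ W))

nbrSize-cong : ∀ {n} (ad ad′ : Adj n) (S W : Subset n) →
               (∀ v → not (v ∈ᵇ W) ∧ hasNbr ad W v ≡ not (v ∈ᵇ W) ∧ hasNbr ad′ W v) →
               nbrSize ad S W ≡ nbrSize ad′ S W
nbrSize-cong {n} ad ad′ S W e = tally-cong (λ v → cong ((v ∈ᵇ S) ∧_) (e v)) (allFin n)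

module SimpleGraph {n : ℕ} (adj : Adj n) (symm : ∀ u v → adj u v ≡ adj v u) (irrefl : ∀ v → adj v v ≡ false)
                   (a : Fin n) where

  V∖a V∖N[a] : Subset n
  V∖a    = ⊤ ─ ⁅ a ⁆
  V∖N[a] = ⊤ ─ closedNbhd adj a

  disjoint-closedNbhd : ∀ W → disjointᵇ (closedNbhd adj a) W ≡ not ((a ∈ᵇ W) ∨ hasNbr adj W a)
  disjoint-closedNbhd W = begin
    disjointᵇ (closedNbhd adj a) W
      ≡⟨ disjoint-any (closedNbhd adj a) W ⟩
    not (anyV (λ v → (v ∈ᵇ closedNbhd adj a) ∧ (v ∈ᵇ W)))
      ≡⟨ cong not (any-cong split (allFin n)) ⟩
    not (anyV (λ v → ((v == a) ∧ (v ∈ᵇ W)) ∨ ((v ∈ᵇ W) ∧ adj v a)))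
      ≡⟨ cong not (any-∨ (λ v → (v == a) ∧ (v ∈ᵇ W)) (λ v → (v ∈ᵇ W) ∧ adj v a) (allFin n)) ⟩
    not (anyV (λ v → (v == a) ∧ (v ∈ᵇ W)) ∨ hasNbr adj W a)
      ≡⟨ cong (λ b → not (b ∨ hasNbr adj W a)) (any-at a (λ v → v ∈ᵇ W)) ⟩
    not ((a ∈ᵇ W) ∨ hasNbr adj W a) ∎
    where
      split : ∀ v → (v ∈ᵇ closedNbhd adj a) ∧ (v ∈ᵇ W) ≡ ((v == a) ∧ (v ∈ᵇ W)) ∨ ((v ∈ᵇ W) ∧ adj v a)
      split v rewrite lookup-closedNbhd adj a v | symm a v with v == a | v ∈ᵇ W
      ... | true  | true  = refl
      ... | true  | false = refl
      ... | false | w     = ∧-comm (adj v a) w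

  avoid-nbr : ∀ W v → hasNbr adj W a ≡ false → adj a v ≡ true → v ∈ᵇ W ≡ false
  avoid-nbr W v h av with v ∈ᵇ W in vW
  ... | false = refl
  ... | true  = trans (sym witness) h
    where
      witness : hasNbr adj W a ≡ true
      witness = any-∈ (∈-allFin v) (trans (cong₂ _∧_ vW (symm v a)) av)

  hasNbr-contract : ∀ W v → v ∈ᵇ W ≡ false →
                    hasNbr (contractAdj adj a) W v ≡ hasNbr adj W v ∨ (hasNbr adj W a ∧ adj a v)
  hasNbr-contract W v vW = begin
    hasNbr (contractAdj adj a) W v
      ≡⟨ any-cong split (allFin n) ⟩
    anyV (λ w → ((w ∈ᵇ W) ∧ adj w v) ∨ (((w ∈ᵇ W) ∧ adj w a) ∧ adj a v))
      ≡⟨ any-∨ (λ w → (w ∈ᵇ W) ∧ adj w v) (λ w → ((w ∈ᵇ W) ∧ adj w a) ∧ adj a v) (allFin n) ⟩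
    hasNbr adj W v ∨ anyV (λ w → ((w ∈ᵇ W) ∧ adj w a) ∧ adj a v)
      ≡⟨ cong (hasNbr adj W v ∨_) (any-∧ʳ (λ w → (w ∈ᵇ W) ∧ adj w a) (adj a v) (allFin n)) ⟩
    hasNbr adj W v ∨ (hasNbr adj W a ∧ adj a v) ∎
    where
      split : ∀ w → (w ∈ᵇ W) ∧ contractAdj adj a w v ≡ ((w ∈ᵇ W) ∧ adj w v) ∨ (((w ∈ᵇ W) ∧ adj w a) ∧ adj a v)
      split w with w Fin.≟ v
      ... | yes refl rewrite vW = refl
      ... | no _ with w ∈ᵇ W
      ...   | false = refl
      ...   | true rewrite symm a w | ∧-identityʳ (adj a v) = refl

  module Insert (W : Subset n) (a∉W : a ∈ᵇ W ≡ false) where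

    W⁺ : Subset n
    W⁺ = W [ a ]≔ true

    size-insert : size W⁺ ≡ suc (size W)
    size-insert = begin
      size W⁺                         ≡⟨ sym (tally-+ pointwise (allFin n)) ⟩
      count (λ v → v == a) +ℕ size W  ≡⟨ cong (_+ℕ size W) (count-single a) ⟩
      suc (size W)                    ∎
      where
        pointwise : ∀ v → bit (v == a) +ℕ bit (v ∈ᵇ W) ≡ bit (v ∈ᵇ W⁺)
        pointwise v rewrite lookup-insert W a v with v Fin.≟ a
        ... | yes refl rewrite a∉W = refl
        ... | no _     = refl

    nbr-G : nbrSize adj ⊤ W ≡ bit (hasNbr adj W a) +ℕ nbrSize adj V∖a W
    nbr-G = begin
      nbrSize adj ⊤ W                                                     ≡⟨ sym (tally-+ pointwise (allFin n)) ⟩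
      count (λ v → (v == a) ∧ hasNbr adj W a) +ℕ nbrSize adj V∖a W        ≡⟨ cong (_+ℕ nbrSize adj V∖a W) (count-at a (hasNbr adj W a)) ⟩
      bit (hasNbr adj W a) +ℕ nbrSize adj V∖a W                           ∎
      where
        pointwise : ∀ v → bit ((v == a) ∧ hasNbr adj W a) +ℕ bit ((v ∈ᵇ V∖a) ∧ not (v ∈ᵇ W) ∧ hasNbr adj W v)
                          ≡ bit ((v ∈ᵇ ⊤) ∧ not (v ∈ᵇ W) ∧ hasNbr adj W v)
        pointwise v rewrite lookup-⊤─ ⁅ a ⁆ v | lookup-⁅⁆ a v | lookup-⊤ v with v Fin.≟ a
        ... | yes refl rewrite a∉W = ℕP.+-identityʳ (bit (hasNbr adj W v))
        ... | no _     = refl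

    nbr-contract-avoid : hasNbr adj W a ≡ false → nbrSize (contractAdj adj a) V∖a W ≡ nbrSize adj V∖a W
    nbr-contract-avoid h = nbrSize-cong (contractAdj adj a) adj V∖a W pointwise
      where
        pointwise : ∀ v → not (v ∈ᵇ W) ∧ hasNbr (contractAdj adj a) W v ≡ not (v ∈ᵇ W) ∧ hasNbr adj W v
        pointwise v with v ∈ᵇ W in vW
        ... | true  = refl
        ... | false rewrite hasNbr-contract W v vW | h = ∨-identityʳ (hasNbr adj W v)

    -- If a has no neighbour in W, then N(W ∪ {a}) is the disjoint union of N(a)
    -- and the neighbourhood of W in G - N[a].
    nbr-insert-avoid : hasNbr adj W a ≡ false → nbrSize adj ⊤ W⁺ ≡ degree adj a +ℕ nbrSize adj V∖N[a] W
    nbr-insert-avoid h = sym (tally-+ pointwise (allFin n))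
      where
        pointwise : ∀ v → bit (adj a v) +ℕ bit ((v ∈ᵇ V∖N[a]) ∧ not (v ∈ᵇ W) ∧ hasNbr adj W v)
                          ≡ bit ((v ∈ᵇ ⊤) ∧ not (v ∈ᵇ W⁺) ∧ hasNbr adj W⁺ v)
        pointwise v rewrite lookup-⊤─ (closedNbhd adj a) v | lookup-closedNbhd adj a v | lookup-⊤ v
                          | lookup-insert W a v | hasNbr-insert adj W a v with v Fin.≟ a
        ... | yes refl rewrite irrefl v = refl
        ... | no _ with adj a v in av
        ...   | true rewrite avoid-nbr W v h av = refl
        ...   | false = refl

    nbr-insert-meet : hasNbr adj W a ≡ true → nbrSize adj ⊤ W⁺ ≡ nbrSize (contractAdj adj a) V∖a W
    nbr-insert-meet h = tally-cong pointwise (allFin n)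
      where
        pointwise : ∀ v → (v ∈ᵇ ⊤) ∧ not (v ∈ᵇ W⁺) ∧ hasNbr adj W⁺ v
                          ≡ (v ∈ᵇ V∖a) ∧ not (v ∈ᵇ W) ∧ hasNbr (contractAdj adj a) W v
        pointwise v rewrite lookup-⊤ v | lookup-insert W a v | hasNbr-insert adj W a v
                          | lookup-⊤─ ⁅ a ⁆ v | lookup-⁅⁆ a v with v Fin.≟ a
        ... | yes refl = refl
        ... | no _ with v ∈ᵇ W in vW
        ...   | true  = refl
        ...   | false rewrite hasNbr-contract W v vW | h = ∨-comm (adj a v) (hasNbr adj W v)

sumOver : ∀ {A : Set} → (A → ℚ) → List A → ℚ
sumOver f = foldr (λ W acc → f W + acc) 0ℚ

module _ {A : Set} where

  sumOver-++ : ∀ (f : A → ℚ) xs ys → sumOver f (xs ++ ys) ≡ sumOver f xs + sumOver f ys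
  sumOver-++ f []       ys = sym (ℚP.+-identityˡ (sumOver f ys))
  sumOver-++ f (x ∷ xs) ys = trans (cong (f x +_) (sumOver-++ f xs ys)) (sym (ℚP.+-assoc (f x) _ _))

  sumOver-map : ∀ {B : Set} (f : A → ℚ) (g : B → A) xs → sumOver f (map g xs) ≡ sumOver (λ W → f (g W)) xs
  sumOver-map f g []       = refl
  sumOver-map f g (x ∷ xs) = cong (f (g x) +_) (sumOver-map f g xs)

  sumOver-zero : ∀ {f : A → ℚ} → (∀ W → f W ≡ 0ℚ) → ∀ xs → sumOver f xs ≡ 0ℚ
  sumOver-zero e []       = refl
  sumOver-zero e (x ∷ xs) rewrite e x | sumOver-zero e xs = refl

  sumOver-+ : ∀ (f g : A → ℚ) xs → sumOver (λ W → f W + g W) xs ≡ sumOver f xs + sumOver g xs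
  sumOver-+ f g []       = refl
  sumOver-+ f g (x ∷ xs) = trans (cong ((f x + g x) +_) (sumOver-+ f g xs))
    (solve 4 (λ a b c d → (a :+ b) :+ (c :+ d) := (a :+ c) :+ (b :+ d)) refl (f x) (g x) (sumOver f xs) (sumOver g xs))

  sumOver-lin : ∀ (f g : A → ℚ) c xs → sumOver (λ W → f W - c * g W) xs ≡ sumOver f xs - c * sumOver g xs
  sumOver-lin f g c []       = solve 1 (λ c → con 0ℚ := con 0ℚ :- c :* con 0ℚ) refl c
  sumOver-lin f g c (x ∷ xs) = trans (cong ((f x - c * g x) +_) (sumOver-lin f g c xs))
    (solve 5 (λ c a b s t → (a :- c :* b) :+ (s :- c :* t) := (a :+ s) :- c :* (b :+ t)) refl
           c (f x) (g x) (sumOver f xs) (sumOver g xs))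

sumOver-subsets : ∀ {n} (f : Subset (suc n) → ℚ) →
  sumOver f (subsets (suc n)) ≡ sumOver (λ W → f (false ∷ W)) (subsets n) + sumOver (λ W → f (true ∷ W)) (subsets n)
sumOver-subsets {n} f =
  trans (sumOver-++ f (map (false ∷_) (subsets n)) (map (true ∷_) (subsets n)))
        (cong₂ _+_ (sumOver-map f (false ∷_) (subsets n)) (sumOver-map f (true ∷_) (subsets n)))

sumOver-pairs : ∀ {n} (a : Fin n) (f : Subset n → ℚ) →
                (∀ W → a ∈ᵇ W ≡ false → f W + f (W [ a ]≔ true) ≡ 0ℚ) → sumOver f (subsets n) ≡ 0ℚ
sumOver-pairs {suc n} zero f pairs = begin
  sumOver f (subsets (suc n))
    ≡⟨ sumOver-subsets f ⟩
  sumOver (λ W → f (false ∷ W)) (subsets n) + sumOver (λ W → f (true ∷ W)) (subsets n)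
    ≡⟨ sym (sumOver-+ (λ W → f (false ∷ W)) (λ W → f (true ∷ W)) (subsets n)) ⟩
  sumOver (λ W → f (false ∷ W) + f (true ∷ W)) (subsets n)
    ≡⟨ sumOver-zero (λ W → pairs (false ∷ W) refl) (subsets n) ⟩
  0ℚ ∎
sumOver-pairs {suc n} (suc a) f pairs = begin
  sumOver f (subsets (suc n))
    ≡⟨ sumOver-subsets f ⟩
  sumOver (λ W → f (false ∷ W)) (subsets n) + sumOver (λ W → f (true ∷ W)) (subsets n)
    ≡⟨ cong₂ _+_ (sumOver-pairs a (λ W → f (false ∷ W)) (λ W → pairs (false ∷ W)))
                 (sumOver-pairs a (λ W → f (true ∷ W)) (λ W → pairs (true ∷ W))) ⟩
  0ℚ + 0ℚ
    ≡⟨ ℚP.+-identityʳ 0ℚ ⟩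
  0ℚ ∎

^-+ : ∀ (y : ℚ) m k → y ^ (m +ℕ k) ≡ (y ^ m) * (y ^ k)
^-+ y zero    k = sym (ℚP.*-identityˡ (y ^ k))
^-+ y (suc m) k = trans (cong (y *_) (^-+ y m k)) (sym (ℚP.*-assoc y (y ^ m) (y ^ k)))

weight : ∀ {n} → Adj n → Subset n → (Subset n → Bool) → ℚ → ℚ → Subset n → ℚ
weight ad S c x y W = if (W ⊆ᵇ S) ∧ c W then (x ^ size W) * (y ^ nbrSize ad S W) else 0ℚ

module _ {n} (ad : Adj n) (S : Subset n) (c : Subset n → Bool) (x y : ℚ) (W : Subset n) where

  weight-in : W ⊆ᵇ S ≡ true → c W ≡ true → weight ad S c x y W ≡ (x ^ size W) * (y ^ nbrSize ad S W)
  weight-in W⊆S cW rewrite W⊆S | cW = refl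

  weight-outside : W ⊆ᵇ S ≡ false → weight ad S c x y W ≡ 0ℚ
  weight-outside W⊈S rewrite W⊈S = refl

  weight-excluded : c W ≡ false → weight ad S c x y W ≡ 0ℚ
  weight-excluded ¬cW rewrite ¬cW | ∧-zeroʳ (W ⊆ᵇ S) = refl

module Recurrence {n : ℕ} (adj : Adj n) (symm : ∀ u v → adj u v ≡ adj v u) (irrefl : ∀ v → adj v v ≡ false)
                  (a : Fin n) (x y : ℚ) where

  open SimpleGraph adj symm irrefl a

  D c : ℚ
  D = (1ℚ - x) - y
  c = x * (y ^ degree adj a)

  always avoids : Subset n → Bool
  always _  = true
  avoids W = disjointᵇ (closedNbhd adj a) W

  ωG ωGN ωGc ωGa ωavoid : Subset n → ℚ
  ωG     = weight adj ⊤ always x y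
  ωGN    = weight adj V∖N[a] always x y
  ωGc    = weight (contractAdj adj a) V∖a always x y
  ωGa    = weight adj V∖a always x y
  ωavoid = weight adj ⊤ avoids x y

  ω : Subset n → ℚ
  ω W = ωG W - c * ωGN W - x * ωGc W - y * ωGa W - D * ωavoid W

  -- The ring identities behind the cancellation of a pair W, W ∪ {a}:
  -- with X = x^|W|, when a has no neighbour in W ...
  cancel-avoid : ∀ {g₁ g₂ g₃ g₄ g₅ g⁺} (X Yk Ym Yd : ℚ) →
    g₁ ≡ X * Yk → g₂ ≡ X * Ym → g₃ ≡ X * Yk → g₄ ≡ X * Yk → g₅ ≡ X * Yk → g⁺ ≡ (x * X) * (Yd * Ym) →
    (g₁ - (x * Yd) * g₂ - x * g₃ - y * g₄ - D * g₅) + g⁺ ≡ 0ℚ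
  cancel-avoid X Yk Ym Yd refl refl refl refl refl refl =
    solve 6 (λ x y X Yk Ym Yd →
      (X :* Yk :- (x :* Yd) :* (X :* Ym) :- x :* (X :* Yk) :- y :* (X :* Yk) :- ((con 1ℚ :- x) :- y) :* (X :* Yk))
        :+ (x :* X) :* (Yd :* Ym) := con 0ℚ) refl x y X Yk Ym Yd

  -- ... and when it has one.
  cancel-meet : ∀ {g₁ g₂ g₃ g₄ g₅ g⁺} (X Yk Yj Yd : ℚ) →
    g₁ ≡ X * (y * Yk) → g₂ ≡ 0ℚ → g₃ ≡ X * Yj → g₄ ≡ X * Yk → g₅ ≡ 0ℚ → g⁺ ≡ (x * X) * Yj →
    (g₁ - (x * Yd) * g₂ - x * g₃ - y * g₄ - D * g₅) + g⁺ ≡ 0ℚ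
  cancel-meet X Yk Yj Yd refl refl refl refl refl refl =
    solve 6 (λ x y X Yk Yj Yd →
      (X :* (y :* Yk) :- (x :* Yd) :* con 0ℚ :- x :* (X :* Yj) :- y :* (X :* Yk) :- ((con 1ℚ :- x) :- y) :* con 0ℚ)
        :+ (x :* X) :* Yj := con 0ℚ) refl x y X Yk Yj Yd

  drop-zeros : ∀ {g₂ g₃ g₄ g₅} (g₁ : ℚ) → g₂ ≡ 0ℚ → g₃ ≡ 0ℚ → g₄ ≡ 0ℚ → g₅ ≡ 0ℚ →
    g₁ - c * g₂ - x * g₃ - y * g₄ - D * g₅ ≡ g₁
  drop-zeros g₁ refl refl refl refl =
    solve 5 (λ c x y D g₁ → g₁ :- c :* con 0ℚ :- x :* con 0ℚ :- y :* con 0ℚ :- D :* con 0ℚ := g₁) refl c x y D g₁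

  module _ (W : Subset n) (a∉W : a ∈ᵇ W ≡ false) where

    open Insert W a∉W

    a∈W⁺ : a ∈ᵇ W⁺ ≡ true
    a∈W⁺ = lookup∘update a W true

    W⊆V∖a : W ⊆ᵇ V∖a ≡ true
    W⊆V∖a = trans (⊆-complement ⁅ a ⁆ W) (trans (disjoint-⁅⁆ a W) (cong not a∉W))

    W-avoids : disjointᵇ (closedNbhd adj a) W ≡ not (hasNbr adj W a)
    W-avoids = trans (disjoint-closedNbhd W) (cong (λ b → not (b ∨ hasNbr adj W a)) a∉W)

    W⊆V∖N[a] : W ⊆ᵇ V∖N[a] ≡ not (hasNbr adj W a)
    W⊆V∖N[a] = trans (⊆-complement (closedNbhd adj a) W) W-avoids

    W⁺-meets : disjointᵇ (closedNbhd adj a) W⁺ ≡ false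
    W⁺-meets = trans (disjoint-closedNbhd W⁺) (cong (λ b → not (b ∨ hasNbr adj W⁺ a)) a∈W⁺)

    -- W⁺ contains a, so it only contributes to J(G).
    ω-insert : ω W⁺ ≡ ωG W⁺
    ω-insert = drop-zeros (ωG W⁺)
      (weight-outside adj V∖N[a] always x y W⁺ (trans (⊆-complement (closedNbhd adj a) W⁺) W⁺-meets))
      (weight-outside (contractAdj adj a) V∖a always x y W⁺ W⁺⊈V∖a)
      (weight-outside adj V∖a always x y W⁺ W⁺⊈V∖a)
      (weight-excluded adj ⊤ avoids x y W⁺ W⁺-meets)
      where
        W⁺⊈V∖a : W⁺ ⊆ᵇ V∖a ≡ false
        W⁺⊈V∖a = trans (⊆-complement ⁅ a ⁆ W⁺) (trans (disjoint-⁅⁆ a W⁺) (cong not a∈W⁺))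

    pair-avoid : hasNbr adj W a ≡ false → ω W + ωG W⁺ ≡ 0ℚ
    pair-avoid h = cancel-avoid X (y ^ nbrSize adj V∖a W) (y ^ nbrSize adj V∖N[a] W) (y ^ degree adj a)
      (trans (weight-in adj ⊤ always x y W (⊆-⊤ W) refl) (cong (λ k → X * (y ^ k)) nbr-G-avoid))
      (weight-in adj V∖N[a] always x y W (trans W⊆V∖N[a] (cong not h)) refl)
      (trans (weight-in (contractAdj adj a) V∖a always x y W W⊆V∖a refl) (cong (λ k → X * (y ^ k)) (nbr-contract-avoid h)))
      (weight-in adj V∖a always x y W W⊆V∖a refl)
      (trans (weight-in adj ⊤ avoids x y W (⊆-⊤ W) (trans W-avoids (cong not h))) (cong (λ k → X * (y ^ k)) nbr-G-avoid))
      (trans (weight-in adj ⊤ always x y W⁺ (⊆-⊤ W⁺) refl)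
             (cong₂ _*_ (cong (x ^_) size-insert)
                        (trans (cong (y ^_) (nbr-insert-avoid h)) (^-+ y (degree adj a) (nbrSize adj V∖N[a] W)))))
      where
        X : ℚ
        X = x ^ size W
        nbr-G-avoid : nbrSize adj ⊤ W ≡ nbrSize adj V∖a W
        nbr-G-avoid = trans nbr-G (cong (λ b → bit b +ℕ nbrSize adj V∖a W) h)

    pair-meet : hasNbr adj W a ≡ true → ω W + ωG W⁺ ≡ 0ℚ
    pair-meet h = cancel-meet X (y ^ nbrSize adj V∖a W) (y ^ nbrSize (contractAdj adj a) V∖a W) (y ^ degree adj a)
      (trans (weight-in adj ⊤ always x y W (⊆-⊤ W) refl)
             (cong (λ k → X * (y ^ k)) (trans nbr-G (cong (λ b → bit b +ℕ nbrSize adj V∖a W) h))))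
      (weight-outside adj V∖N[a] always x y W (trans W⊆V∖N[a] (cong not h)))
      (weight-in (contractAdj adj a) V∖a always x y W W⊆V∖a refl)
      (weight-in adj V∖a always x y W W⊆V∖a refl)
      (weight-excluded adj ⊤ avoids x y W (trans W-avoids (cong not h)))
      (trans (weight-in adj ⊤ always x y W⁺ (⊆-⊤ W⁺) refl)
             (cong₂ _*_ (cong (x ^_) size-insert) (cong (y ^_) (nbr-insert-meet h))))
      where
        X : ℚ
        X = x ^ size W

    pair-vanishes : ω W + ω W⁺ ≡ 0ℚ
    pair-vanishes = trans (cong (ω W +_) ω-insert) (by-cases (hasNbr adj W a) refl)
      where
        by-cases : ∀ b → hasNbr adj W a ≡ b → ω W + ωG W⁺ ≡ 0ℚ
        by-cases false h = pair-avoid h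
        by-cases true  h = pair-meet h

  recurrence : J adj ⊤ x y - c * J adj V∖N[a] x y - x * J (contractAdj adj a) V∖a x y - y * J adj V∖a x y
               ≡ D * Jc adj ⊤ avoids x y
  recurrence = x∙y⁻¹≈ε⇒x≈y _ _ (begin
    sumOver ωG Ws - c * sumOver ωGN Ws - x * sumOver ωGc Ws - y * sumOver ωGa Ws - D * sumOver ωavoid Ws
      ≡⟨ sym expand ⟩
    sumOver ω Ws
      ≡⟨ sumOver-pairs a ω pair-vanishes ⟩
    0ℚ ∎)
    where
      Ws = subsets n
      expand : sumOver ω Ws ≡ sumOver ωG Ws - c * sumOver ωGN Ws - x * sumOver ωGc Ws - y * sumOver ωGa Ws
                                - D * sumOver ωavoid Ws
      expand =
        trans (sumOver-lin (λ W → ωG W - c * ωGN W - x * ωGc W - y * ωGa W) ωavoid D Ws) (cong (_- D * sumOver ωavoid Ws)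
        (trans (sumOver-lin (λ W → ωG W - c * ωGN W - x * ωGc W) ωGa y Ws) (cong (_- y * sumOver ωGa Ws)
        (trans (sumOver-lin (λ W → ωG W - c * ωGN W) ωGc x Ws) (cong (_- x * sumOver ωGc Ws)
        (sumOver-lin ωG ωGN c Ws))))))

÷-solve : ∀ (p q t : ℚ) .{{_ : NonZero q}} → p ≡ q * t → t ≡ p ÷ q
÷-solve p q t p≡qt = sym (begin
  p * 1/ q          ≡⟨ cong (_* 1/ q) (trans p≡qt (ℚP.*-comm q t)) ⟩
  (t * q) * 1/ q    ≡⟨ ℚP.*-assoc t q (1/ q) ⟩
  t * (q * 1/ q)    ≡⟨ cong (t *_) (ℚP.*-inverseʳ q) ⟩
  t * 1ℚ            ≡⟨ ℚP.*-identityʳ t ⟩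
  t                 ∎)

lemma5 : ∀ (n : ℕ) (adj : Adj n) → IsSimpleGraph adj → (a : Fin n) → (x y : ℚ) → (h : x ≢ 1ℚ - y) →
    Jc adj ⊤ (λ W → disjointᵇ (closedNbhd adj a) W) x y
      ≡ divDenom ((((J adj ⊤ x y - (x * (y ^ degree adj a)) * J adj (⊤ ─ closedNbhd adj a) x y)
                    - x * J (contractAdj adj a) (⊤ ─ ⁅ a ⁆) x y)
                    - y * J adj (⊤ ─ ⁅ a ⁆) x y)) x y h
lemma5 n adj (symm , irrefl) a x y h =
  ÷-solve _ D _ {{≢-nonZero (nonzero-denom x y h)}} recurrence
  where open Recurrence adj symm irrefl a x y
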